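{- Let $G = K_{n_1}\,\square\,\cdots\,\square\, K_{n_r}$ be a Hamming graph ($r\ge 1$, $n_i\ge 2$) and $X\subseteq V(G)$. The following are equivalent: (i) $X$ is a total mutual-visibility set of $G$; (ii) there are no $u,v\in X$ with $d_G(u,v)=2$; (iii) every Cartesian square of $G$ is $X$-suitable.
   Context: $\square$ is the Cartesian product of graphs; a Hamming graph is a Cartesian product of complete graphs, with vertices $r$-tuples $(u_1,\dots,u_r)$, $u_i\in[n_i]$, adjacent iff they differ in exactly one coordinate. $d_G$ is the shortest-path distance. For $X\subseteq V(G)$, vertices $x,y$ are $X$-visible if some shortest $x,y$-path has no internal vertex in $X$; $X$ is a total mutual-visibility set if every two vertices of $G$ are $X$-visible. A Cartesian square of $G$ is a 4-cycle on vertices $u,u',u'',u'''$ for which there are indices $i<j$ and values $u_i\ne u_i'$, $u_j\ne u_j'$ such that $u$ has coordinates $(u_i,u_j)$ in positions $i,j$, $u'$ has $(u_i,u_j')$, $u''$ has $(u_i',u_j')$, $u'''$ has $(u_i',u_j)$, and all four agree in all other coordinates. A Cartesian square is $X$-suitable if $X$ contains no diametral (i.e., distance-2, non-adjacent) pair of its vertices. -}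

module Defs where

open import Data.Nat using (ℕ; zero; suc)
open import Data.Nat as ℕ using ()
open import Data.Fin using (Fin; zero; suc) renaming (_<_ to _<ᶠ_)
open import Data.Vec using (Vec; []; _∷_; lookup)
open import Data.Bool using (Bool; true)
open import Data.Product using (Σ; Σ-syntax; _×_; _,_)
open import Data.Unit using (⊤; tt)
open import Relation.Nullary using (¬_)
open import Relation.Binary.PropositionalEquality using (_≡_; _≢_)

module GraphNotions {V : Set} (Adj : V → V → Set) where

  data Walk : V → V → ℕ → Set where
    here : ∀ {u} → Walk u u 0
    step : ∀ {u v w n} → Adj u v → Walk v w n → Walk u w (suc n)

  IsShortest : ∀ {u w n} → Walk u w n → Set
  IsShortest {u} {w} {n} _ = ∀ m → Walk u w m → n ℕ.≤ m

  Distance : V → V → ℕ → Set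
  Distance u w k = Σ (Walk u w k) IsShortest

  _∈X_ : V → (V → Bool) → Set
  u ∈X X = X u ≡ true

  AvoidFrom : (V → Bool) → ∀ {u w n} → Walk u w n → Set
  AvoidFrom X here = ⊤
  AvoidFrom X (step {u} _ p) = ¬ (u ∈X X) × AvoidFrom X p

  InternalAvoids : (V → Bool) → ∀ {u w n} → Walk u w n → Set
  InternalAvoids X here = ⊤
  InternalAvoids X (step _ p) = AvoidFrom X p

  Visible : (V → Bool) → V → V → Set
  Visible X x y = Σ ℕ λ n → Σ (Walk x y n) λ p → IsShortest p × InternalAvoids X p

  TotalMutualVisibility : (V → Bool) → Set
  TotalMutualVisibility X = ∀ x y → Visible X x y

Vertex : ∀ {r} → Vec ℕ r → Set
Vertex [] = ⊤
Vertex (m ∷ ns) = Fin m × Vertex ns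

coord : ∀ {r} (ns : Vec ℕ r) → Vertex ns → (i : Fin r) → Fin (lookup ns i)
coord (m ∷ ns) (x , _) zero = x
coord (m ∷ ns) (_ , xs) (suc i) = coord ns xs i

HAdj : ∀ {r} (ns : Vec ℕ r) → Vertex ns → Vertex ns → Set
HAdj {r} ns u v = Σ (Fin r) λ i →
  coord ns u i ≢ coord ns v i × (∀ j → j ≢ i → coord ns u j ≡ coord ns v j)

module Hamming {r : ℕ} (ns : Vec ℕ r) where
  open GraphNotions (HAdj ns) public

  -- u, u', u'', u''' (in this cyclic order) form a Cartesian square
  CartesianSquare : (u u' u'' u''' : Vertex ns) → Set
  CartesianSquare u u' u'' u''' =
    Σ (Fin r) λ i → Σ (Fin r) λ j → i <ᶠ j ×
    (Σ (Fin (lookup ns i)) λ a → Σ (Fin (lookup ns i)) λ a' →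
     Σ (Fin (lookup ns j)) λ b → Σ (Fin (lookup ns j)) λ b' →
       a ≢ a' × b ≢ b' ×
       (coord ns u i ≡ a × coord ns u j ≡ b) ×
       (coord ns u' i ≡ a × coord ns u' j ≡ b') ×
       (coord ns u'' i ≡ a' × coord ns u'' j ≡ b') ×
       (coord ns u''' i ≡ a' × coord ns u''' j ≡ b) ×
       (∀ k → k ≢ i → k ≢ j →
          coord ns u k ≡ coord ns u' k ×
          coord ns u k ≡ coord ns u'' k ×
          coord ns u k ≡ coord ns u''' k))

  Suitable : (Vertex ns → Bool) → (u u' u'' u''' : Vertex ns) → Set
  Suitable X u u' u'' u''' =
    ¬ (u ∈X X × u'' ∈X X) × ¬ (u' ∈X X × u''' ∈X X)

  NoDistanceTwoPair : (Vertex ns → Bool) → Set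
  NoDistanceTwoPair X = ∀ u v → u ∈X X → v ∈X X → ¬ Distance u v 2

  AllSquaresSuitable : (Vertex ns → Bool) → Set
  AllSquaresSuitable X = ∀ u u' u'' u''' →
    CartesianSquare u u' u'' u''' → Suitable X u u' u'' u'''

{-# OPTIONS --safe #-}
module Submission where

-- The graph distance of a Hamming graph is the Hamming distance, so two vertices
-- are at distance 2 iff they differ in exactly two coordinates i ≠ j, i.e. iff they
-- are a diagonal of a Cartesian square; this gives (ii) ⇔ (iii). For (ii) ⇒ (i),
-- a geodesic from x to y with no internal vertex in X is built one step at a time:
-- of the two vertices obtained by correcting two different coordinates of x, which
-- are at distance 2 from each other, one lies outside X. For (i) ⇒ (ii), if u, v ∈ X differ exactly in
-- coordinates i and j, the only common neighbours of the two middle vertices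
-- u[i ≔ vᵢ] and u[j ≔ vⱼ] are u and v, so these middle vertices are not X-visible.

open import Defs
open import Data.Nat using (ℕ; zero; suc; _≤_; s≤s)
open import Data.Nat.Properties using (≤-refl; ≤-reflexive; ≤-trans; ≤-antisym; n≤1+n; suc-injective)
open import Data.Fin using (Fin; zero; suc) renaming (_<_ to _<ᶠ_)
open import Data.Fin.Properties using (_≟_; <-cmp; <⇒≢)
open import Data.Vec using (Vec; []; _∷_; lookup)
open import Data.Bool using (Bool; true)
open import Data.Bool.Properties using () renaming (_≟_ to _≟ᵇ_)
open import Data.Product using (Σ-syntax; _×_; _,_; proj₁; proj₂)
open import Data.Sum using (_⊎_; inj₁; inj₂)
open import Data.Unit using (tt)
open import Data.Empty using (⊥-elim)
open import Relation.Nullary using (¬_; Dec; yes; no)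
open import Relation.Binary.Definitions using (tri<; tri≈; tri>)
open import Relation.Binary.PropositionalEquality
  using (_≡_; _≢_; refl; sym; trans; cong; cong₂; subst; ≢-sym; module ≡-Reasoning)
open import Function.Bundles using (_⇔_; mk⇔)

update : ∀ {r} (ns : Vec ℕ r) → Vertex ns → (i : Fin r) → Fin (lookup ns i) → Vertex ns
update (m ∷ ns) (x , xs) zero    a = a , xs
update (m ∷ ns) (x , xs) (suc i) a = x , update ns xs i a

coord-update-≡ : ∀ {r} (ns : Vec ℕ r) u i a → coord ns (update ns u i a) i ≡ a
coord-update-≡ (m ∷ ns) (x , xs) zero    a = refl
coord-update-≡ (m ∷ ns) (x , xs) (suc i) a = coord-update-≡ ns xs i a

coord-update-≢ : ∀ {r} (ns : Vec ℕ r) u {i} a {k} → k ≢ i →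
                 coord ns (update ns u i a) k ≡ coord ns u k
coord-update-≢ (m ∷ ns) (x , xs) {zero}  a {zero}  k≢i = ⊥-elim (k≢i refl)
coord-update-≢ (m ∷ ns) (x , xs) {zero}  a {suc k} k≢i = refl
coord-update-≢ (m ∷ ns) (x , xs) {suc i} a {zero}  k≢i = refl
coord-update-≢ (m ∷ ns) (x , xs) {suc i} a {suc k} k≢i =
  coord-update-≢ ns xs a (λ k≡i → k≢i (cong suc k≡i))

coord-ext : ∀ {r} (ns : Vec ℕ r) {u v} → (∀ k → coord ns u k ≡ coord ns v k) → u ≡ v
coord-ext []       {tt}     {tt}     eq = refl
coord-ext (m ∷ ns) {x , xs} {y , ys} eq = cong₂ _,_ (eq zero) (coord-ext ns (λ k → eq (suc k)))

hamming : ∀ {r} (ns : Vec ℕ r) → Vertex ns → Vertex ns → ℕ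
hamming []       _        _        = 0
hamming (m ∷ ns) (x , xs) (y , ys) with x ≟ y
... | yes _ = hamming ns xs ys
... | no  _ = suc (hamming ns xs ys)

hamming-self : ∀ {r} (ns : Vec ℕ r) u → hamming ns u u ≡ 0
hamming-self []       tt       = refl
hamming-self (m ∷ ns) (x , xs) with x ≟ x
... | yes _   = hamming-self ns xs
... | no  x≢x = ⊥-elim (x≢x refl)

hamming≡0⇒≡ : ∀ {r} (ns : Vec ℕ r) {u v} → hamming ns u v ≡ 0 → u ≡ v
hamming≡0⇒≡ []       {tt}     {tt}     _ = refl
hamming≡0⇒≡ (m ∷ ns) {x , xs} {y , ys} e with x ≟ y
... | yes x≡y = cong₂ _,_ x≡y (hamming≡0⇒≡ ns e)

hamming≡suc⇒differs : ∀ {r} (ns : Vec ℕ r) {u v k} → hamming ns u v ≡ suc k →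
                      Σ[ i ∈ Fin r ] coord ns u i ≢ coord ns v i
hamming≡suc⇒differs (m ∷ ns) {x , xs} {y , ys} e with x ≟ y
... | yes _   = let i , ne = hamming≡suc⇒differs ns e in suc i , ne
... | no  x≢y = zero , x≢y

hamming-update : ∀ {r} (ns : Vec ℕ r) u v i → coord ns u i ≢ coord ns v i →
                 hamming ns u v ≡ suc (hamming ns (update ns u i (coord ns v i)) v)
hamming-update (m ∷ ns) (x , xs) (y , ys) zero x≢y with x ≟ y | y ≟ y
... | yes x≡y | _       = ⊥-elim (x≢y x≡y)
... | no  _   | yes _   = refl
... | no  _   | no  y≢y = ⊥-elim (y≢y refl)
hamming-update (m ∷ ns) (x , xs) (y , ys) (suc i) ne with x ≟ y
... | yes _ = hamming-update ns xs ys i ne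
... | no  _ = cong suc (hamming-update ns xs ys i ne)

hamming-tail-≤ : ∀ {m r} (ns : Vec ℕ r) (x y : Fin m) xs ys →
                 hamming ns xs ys ≤ hamming (m ∷ ns) (x , xs) (y , ys)
hamming-tail-≤ ns x y xs ys with x ≟ y
... | yes _ = ≤-refl
... | no  _ = n≤1+n _

hamming-update-≤ : ∀ {r} (ns : Vec ℕ r) u i a v →
                   hamming ns (update ns u i a) v ≤ suc (hamming ns u v)
hamming-update-≤ (m ∷ ns) (x , xs) zero a (y , ys) with a ≟ y
... | yes _ = ≤-trans (hamming-tail-≤ ns x y xs ys) (n≤1+n _)
... | no  _ = s≤s (hamming-tail-≤ ns x y xs ys)
hamming-update-≤ (m ∷ ns) (x , xs) (suc i) a (y , ys) with x ≟ y
... | yes _ = hamming-update-≤ ns xs i a ys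
... | no  _ = s≤s (hamming-update-≤ ns xs i a ys)

module _ {r : ℕ} (ns : Vec ℕ r) where
  open Hamming ns

  private
    infixl 8 _[_≔_]
    infixl 7 _‼_

    _‼_ : Vertex ns → (i : Fin r) → Fin (lookup ns i)
    u ‼ i = coord ns u i

    _[_≔_] : Vertex ns → (i : Fin r) → Fin (lookup ns i) → Vertex ns
    u [ i ≔ a ] = update ns u i a

  update-unique : ∀ {x z i a} → z ‼ i ≡ a → (∀ k → k ≢ i → z ‼ k ≡ x ‼ k) →
                  z ≡ x [ i ≔ a ]
  update-unique {x} {z} {i} {a} zᵢ≡a agree = coord-ext ns coordinatewise
    where
      coordinatewise : ∀ k → z ‼ k ≡ x [ i ≔ a ] ‼ k
      coordinatewise k with k ≟ i
      ... | yes refl = trans zᵢ≡a (sym (coord-update-≡ ns x k a))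
      ... | no  k≢i  = trans (agree k k≢i) (sym (coord-update-≢ ns x a k≢i))

  update-adjacent : ∀ {x i a} → a ≢ x ‼ i → HAdj ns x (x [ i ≔ a ])
  update-adjacent {x} {i} {a} a≢xᵢ =
    i , (λ e → a≢xᵢ (sym (trans e (coord-update-≡ ns x i a)))) ,
    λ k k≢i → sym (coord-update-≢ ns x a k≢i)

  hamming-adjacent-≤ : ∀ {x y z} → HAdj ns x y → hamming ns x z ≤ suc (hamming ns y z)
  hamming-adjacent-≤ {x} {y} {z} (i , _ , agree) =
    subst (λ w → hamming ns w z ≤ suc (hamming ns y z))
          (sym (update-unique refl agree))
          (hamming-update-≤ ns y i (x ‼ i) z)

  hamming-descent : ∀ {x y k} → hamming ns x y ≡ suc k →
                    Σ[ i ∈ Fin r ] x ‼ i ≢ y ‼ i × hamming ns (x [ i ≔ y ‼ i ]) y ≡ k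
  hamming-descent {x} {y} e =
    let i , xᵢ≢yᵢ = hamming≡suc⇒differs ns e
    in  i , xᵢ≢yᵢ , suc-injective (trans (sym (hamming-update ns x y i xᵢ≢yᵢ)) e)

  hamming≡1⇒adjacent : ∀ {x y} → hamming ns x y ≡ 1 → HAdj ns x y
  hamming≡1⇒adjacent {x} e =
    let i , xᵢ≢yᵢ , e₀ = hamming-descent e
    in  subst (HAdj ns x) (hamming≡0⇒≡ ns e₀) (update-adjacent (≢-sym xᵢ≢yᵢ))

  hamming-≤-length : ∀ {x y n} → Walk x y n → hamming ns x y ≤ n
  hamming-≤-length {x} here = ≤-reflexive (hamming-self ns x)
  hamming-≤-length (step xz p) = ≤-trans (hamming-adjacent-≤ xz) (s≤s (hamming-≤-length p))

  geodesic : ∀ {x y} n → hamming ns x y ≡ n → Walk x y n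
  geodesic {x} zero e = subst (λ w → Walk x w 0) (hamming≡0⇒≡ ns e) here
  geodesic (suc n) e =
    let i , xᵢ≢yᵢ , e′ = hamming-descent e
    in  step (update-adjacent (≢-sym xᵢ≢yᵢ)) (geodesic n e′)

  hamming⇒distance : ∀ {x y n} → hamming ns x y ≡ n → Distance x y n
  hamming⇒distance {n = n} e =
    geodesic n e , λ m p → subst (_≤ m) e (hamming-≤-length p)

  distance⇒hamming : ∀ {x y n} → Distance x y n → hamming ns x y ≡ n
  distance⇒hamming (p , shortest) =
    ≤-antisym (hamming-≤-length p) (shortest _ (geodesic _ refl))

  record DiffersExactlyAt (u v : Vertex ns) (i j : Fin r) : Set where
    field
      distinct : i ≢ j
      differs₁ : u ‼ i ≢ v ‼ i
      differs₂ : u ‼ j ≢ v ‼ j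
      agrees   : ∀ k → k ≢ i → k ≢ j → u ‼ k ≡ v ‼ k

  differsExactly-swap : ∀ {u v i j} → DiffersExactlyAt u v i j → DiffersExactlyAt u v j i
  differsExactly-swap D = record
    { distinct = ≢-sym distinct
    ; differs₁ = differs₂
    ; differs₂ = differs₁
    ; agrees   = λ k k≢j k≢i → agrees k k≢i k≢j
    }
    where open DiffersExactlyAt D

  updates-differExactly : ∀ {x i j a b} → i ≢ j → a ≢ x ‼ i → b ≢ x ‼ j →
                          DiffersExactlyAt (x [ i ≔ a ]) (x [ j ≔ b ]) i j
  updates-differExactly {x} {i} {j} {a} {b} i≢j a≢xᵢ b≢xⱼ = record
    { distinct = i≢j
    ; differs₁ = λ e → a≢xᵢ (trans (sym (coord-update-≡ ns x i a))
                                   (trans e (coord-update-≢ ns x b i≢j)))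
    ; differs₂ = λ e → b≢xⱼ (trans (sym (coord-update-≡ ns x j b))
                                   (trans (sym e) (coord-update-≢ ns x a (≢-sym i≢j))))
    ; agrees   = λ k k≢i k≢j → trans (coord-update-≢ ns x a k≢i) (sym (coord-update-≢ ns x b k≢j))
    }

  differsExactly⇒≡updates : ∀ {u v i j} → DiffersExactlyAt u v i j →
                           v ≡ u [ i ≔ v ‼ i ] [ j ≔ v ‼ j ]
  differsExactly⇒≡updates {u} {v} {i} {j} D = update-unique refl agreesOffJ
    where
      open DiffersExactlyAt D
      agreesOffJ : ∀ k → k ≢ j → v ‼ k ≡ u [ i ≔ v ‼ i ] ‼ k
      agreesOffJ k k≢j with k ≟ i
      ... | yes refl = sym (coord-update-≡ ns u k _)
      ... | no  k≢i  = trans (sym (agrees k k≢i k≢j)) (sym (coord-update-≢ ns u _ k≢i))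

  differsExactly⇒hamming≡2 : ∀ {u v i j} → DiffersExactlyAt u v i j → hamming ns u v ≡ 2
  differsExactly⇒hamming≡2 {u} {v} {i} {j} D = begin
    hamming ns u v
      ≡⟨ hamming-update ns u v i differs₁ ⟩
    suc (hamming ns z v)
      ≡⟨ cong suc (hamming-update ns z v j zⱼ≢vⱼ) ⟩
    suc (suc (hamming ns (z [ j ≔ v ‼ j ]) v))
      ≡⟨ cong (λ w → suc (suc (hamming ns w v))) (sym (differsExactly⇒≡updates D)) ⟩
    suc (suc (hamming ns v v))
      ≡⟨ cong (λ n → suc (suc n)) (hamming-self ns v) ⟩
    2 ∎
    where
      open ≡-Reasoning
      open DiffersExactlyAt D
      z = u [ i ≔ v ‼ i ]
      zⱼ≢vⱼ : z ‼ j ≢ v ‼ j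
      zⱼ≢vⱼ e = differs₂ (trans (sym (coord-update-≢ ns u _ (≢-sym distinct))) e)

  differsExactly⇒distance₂ : ∀ {u v i j} → DiffersExactlyAt u v i j → Distance u v 2
  differsExactly⇒distance₂ D = hamming⇒distance (differsExactly⇒hamming≡2 D)

  hamming≡2⇒differsExactly : ∀ {u v} → hamming ns u v ≡ 2 →
                             Σ[ i ∈ Fin r ] Σ[ j ∈ Fin r ] DiffersExactlyAt u v i j
  hamming≡2⇒differsExactly {u} {v} e with hamming-descent e
  ... | i , uᵢ≢vᵢ , e₁ with hamming≡1⇒adjacent e₁
  ... | j , zⱼ≢vⱼ , agree = i , j , record
    { distinct = i≢j
    ; differs₁ = uᵢ≢vᵢ
    ; differs₂ = λ e → zⱼ≢vⱼ (trans (coord-update-≢ ns u _ (≢-sym i≢j)) e)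
    ; agrees   = λ k k≢i k≢j → trans (sym (coord-update-≢ ns u _ k≢i)) (agree k k≢j)
    }
    where
      i≢j : i ≢ j
      i≢j refl = zⱼ≢vⱼ (coord-update-≡ ns u i _)

  common-neighbour : ∀ {x y z i j} → DiffersExactlyAt x y i j → HAdj ns x z → HAdj ns z y →
                     z ≡ x [ i ≔ y ‼ i ] ⊎ z ≡ x [ j ≔ y ‼ j ]
  common-neighbour {x} {y} {z} {i} {j} D (p , xₚ≢zₚ , x≈z) (q , _ , z≈y) = which (p ≟ i) (p ≟ j)
    where
      open DiffersExactlyAt D
      p≢q : p ≢ q
      p≢q refl with i ≟ p
      ... | yes refl = differs₂ (trans (x≈z j (≢-sym distinct)) (z≈y j (≢-sym distinct)))
      ... | no  i≢p  = differs₁ (trans (x≈z i i≢p) (z≈y i i≢p))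
      z≡ : z ≡ x [ p ≔ y ‼ p ]
      z≡ = update-unique (z≈y p p≢q) (λ k k≢p → sym (x≈z k k≢p))
      which : Dec (p ≡ i) → Dec (p ≡ j) → z ≡ x [ i ≔ y ‼ i ] ⊎ z ≡ x [ j ≔ y ‼ j ]
      which (yes refl) _          = inj₁ z≡
      which (no _)     (yes refl) = inj₂ z≡
      which (no p≢i)   (no p≢j)   = ⊥-elim (xₚ≢zₚ (trans (agrees p p≢i p≢j) (sym (z≈y p p≢q))))

  middles-differExactly : ∀ {u v i j} → DiffersExactlyAt u v i j →
                          DiffersExactlyAt (u [ i ≔ v ‼ i ]) (u [ j ≔ v ‼ j ]) i j
  middles-differExactly D = updates-differExactly distinct (≢-sym differs₁) (≢-sym differs₂)
    where open DiffersExactlyAt D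

  common-neighbour-of-middles : ∀ {u v c i j} → DiffersExactlyAt u v i j →
                                HAdj ns (u [ i ≔ v ‼ i ]) c → HAdj ns c (u [ j ≔ v ‼ j ]) →
                                c ≡ u ⊎ c ≡ v
  common-neighbour-of-middles {u} {v} {c} {i} {j} D z₁c cz₂
    with common-neighbour (middles-differExactly D) z₁c cz₂
  ... | inj₁ c≡ = inj₁ (trans c≡ (sym (update-unique (sym (coord-update-≢ ns u _ distinct))
                                                       (λ k k≢i → sym (coord-update-≢ ns u _ k≢i)))))
    where open DiffersExactlyAt D
  ... | inj₂ c≡ = inj₂ (trans c≡ (trans (cong (u [ i ≔ v ‼ i ] [ j ≔_]) (coord-update-≡ ns u j _))
                                         (sym (differsExactly⇒≡updates D))))

  visible-at-distance₂ : ∀ X {x y} → hamming ns x y ≡ 2 → Visible X x y →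
                         Σ[ c ∈ Vertex ns ] HAdj ns x c × HAdj ns c y × ¬ (c ∈X X)
  visible-at-distance₂ X e (n , p , shortest , avoids)
    with trans (sym (distance⇒hamming (p , shortest))) e
  ... | refl = middle p avoids
    where
      middle : ∀ {x y} (p : Walk x y 2) → InternalAvoids X p →
               Σ[ c ∈ Vertex ns ] HAdj ns x c × HAdj ns c y × ¬ (c ∈X X)
      middle (step xc (step cy here)) (c∉X , _) = _ , xc , cy , c∉X

  totalMutualVisibility⇒noDistanceTwoPair : ∀ X → TotalMutualVisibility X → NoDistanceTwoPair X
  totalMutualVisibility⇒noDistanceTwoPair X visible u v u∈X v∈X d
    with hamming≡2⇒differsExactly (distance⇒hamming d)
  ... | i , j , D
    with visible-at-distance₂ X (differsExactly⇒hamming≡2 (middles-differExactly D)) (visible _ _)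
  ... | c , z₁c , cz₂ , c∉X with common-neighbour-of-middles D z₁c cz₂
  ... | inj₁ refl = c∉X u∈X
  ... | inj₂ refl = c∉X v∈X

  two-descents : ∀ {x y k} → hamming ns x y ≡ suc (suc k) →
                 Σ[ i ∈ Fin r ] Σ[ j ∈ Fin r ] i ≢ j ×
                 (x ‼ i ≢ y ‼ i × hamming ns (x [ i ≔ y ‼ i ]) y ≡ suc k) ×
                 (x ‼ j ≢ y ‼ j × hamming ns (x [ j ≔ y ‼ j ]) y ≡ suc k)
  two-descents {x} {y} e with hamming-descent e
  ... | i , xᵢ≢yᵢ , e₁ with hamming-descent e₁
  ... | j , zⱼ≢yⱼ , _ =
    i , j , i≢j , (xᵢ≢yᵢ , e₁) ,
    (xⱼ≢yⱼ , suc-injective (trans (sym (hamming-update ns x y j xⱼ≢yⱼ)) e))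
    where
      i≢j : i ≢ j
      i≢j refl = zⱼ≢yⱼ (coord-update-≡ ns x i _)
      xⱼ≢yⱼ : x ‼ j ≢ y ‼ j
      xⱼ≢yⱼ e = zⱼ≢yⱼ (trans (coord-update-≢ ns x _ (≢-sym i≢j)) e)

  avoiding-step : ∀ X → NoDistanceTwoPair X → ∀ {x y k} → hamming ns x y ≡ suc (suc k) →
                  Σ[ z ∈ Vertex ns ] HAdj ns x z × ¬ (z ∈X X) × hamming ns z y ≡ suc k
  avoiding-step X noPair {x} {y} e with two-descents e
  ... | i , j , i≢j , (xᵢ≢yᵢ , eᵢ) , (xⱼ≢yⱼ , eⱼ)
    with X (x [ i ≔ y ‼ i ]) ≟ᵇ true | X (x [ j ≔ y ‼ j ]) ≟ᵇ true
  ... | no zᵢ∉X | _       = _ , update-adjacent (≢-sym xᵢ≢yᵢ) , zᵢ∉X , eᵢ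
  ... | yes _   | no zⱼ∉X = _ , update-adjacent (≢-sym xⱼ≢yⱼ) , zⱼ∉X , eⱼ
  ... | yes zᵢ∈X | yes zⱼ∈X = ⊥-elim (noPair _ _ zᵢ∈X zⱼ∈X (differsExactly⇒distance₂
          (updates-differExactly i≢j (≢-sym xᵢ≢yᵢ) (≢-sym xⱼ≢yⱼ))))

  avoidFrom-start : ∀ X {z y k} → ¬ (z ∈X X) → (p : Walk z y (suc k)) →
                    InternalAvoids X p → AvoidFrom X p
  avoidFrom-start X z∉X (step _ _) avoids = z∉X , avoids

  avoiding-geodesic : ∀ X → NoDistanceTwoPair X → ∀ {x y} n → hamming ns x y ≡ n →
                      Σ[ p ∈ Walk x y n ] InternalAvoids X p
  avoiding-geodesic X noPair zero e with hamming≡0⇒≡ ns e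
  ... | refl = here , tt
  avoiding-geodesic X noPair (suc zero) e = step (hamming≡1⇒adjacent e) here , tt
  avoiding-geodesic X noPair (suc (suc k)) e =
    let z , xz , z∉X , e′ = avoiding-step X noPair e
        p , avoids = avoiding-geodesic X noPair (suc k) e′
    in  step xz p , avoidFrom-start X z∉X p avoids

  noDistanceTwoPair⇒totalMutualVisibility : ∀ X → NoDistanceTwoPair X → TotalMutualVisibility X
  noDistanceTwoPair⇒totalMutualVisibility X noPair x y =
    let p , avoids = avoiding-geodesic X noPair _ refl
    in  hamming ns x y , p , (λ m q → hamming-≤-length q) , avoids

  square-diagonals : ∀ {u u′ u″ u‴} → CartesianSquare u u′ u″ u‴ →
                     Σ[ i ∈ Fin r ] Σ[ j ∈ Fin r ]
                     DiffersExactlyAt u u″ i j × DiffersExactlyAt u′ u‴ i j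
  square-diagonals (i , j , i<j , a , a′ , b , b′ , a≢a′ , b≢b′ ,
                    (uᵢ , uⱼ) , (u′ᵢ , u′ⱼ) , (u″ᵢ , u″ⱼ) , (u‴ᵢ , u‴ⱼ) , others) =
    i , j ,
    record { distinct = <⇒≢ i<j
           ; differs₁ = λ e → a≢a′ (trans (sym uᵢ) (trans e u″ᵢ))
           ; differs₂ = λ e → b≢b′ (trans (sym uⱼ) (trans e u″ⱼ))
           ; agrees   = λ k k≢i k≢j → proj₁ (proj₂ (others k k≢i k≢j)) } ,
    record { distinct = <⇒≢ i<j
           ; differs₁ = λ e → a≢a′ (trans (sym u′ᵢ) (trans e u‴ᵢ))
           ; differs₂ = λ e → b≢b′ (sym (trans (sym u′ⱼ) (trans e u‴ⱼ)))
           ; agrees   = λ k k≢i k≢j → let e′ , _ , e‴ = others k k≢i k≢j in trans (sym e′) e‴ }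

  differsExactly⇒square : ∀ {u v i j} → i <ᶠ j → DiffersExactlyAt u v i j →
                          CartesianSquare u (u [ j ≔ v ‼ j ]) v (u [ i ≔ v ‼ i ])
  differsExactly⇒square {u} {v} {i} {j} i<j D =
    i , j , i<j , _ , _ , _ , _ , differs₁ , differs₂ ,
    (refl , refl) ,
    (coord-update-≢ ns u _ (<⇒≢ i<j) , coord-update-≡ ns u j _) ,
    (refl , refl) ,
    (coord-update-≡ ns u i _ , coord-update-≢ ns u _ (≢-sym (<⇒≢ i<j))) ,
    λ k k≢i k≢j → sym (coord-update-≢ ns u _ k≢j) , agrees k k≢i k≢j , sym (coord-update-≢ ns u _ k≢i)
    where open DiffersExactlyAt D

  differsExactly⇒∃square : ∀ {u v i j} → DiffersExactlyAt u v i j →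
                           Σ[ u′ ∈ Vertex ns ] Σ[ u‴ ∈ Vertex ns ] CartesianSquare u u′ v u‴
  differsExactly⇒∃square {i = i} {j} D with <-cmp i j
  ... | tri< i<j _ _ = _ , _ , differsExactly⇒square i<j D
  ... | tri≈ _ i≡j _ = ⊥-elim (DiffersExactlyAt.distinct D i≡j)
  ... | tri> _ _ j<i = _ , _ , differsExactly⇒square j<i (differsExactly-swap D)

  noDistanceTwoPair⇒allSquaresSuitable : ∀ X → NoDistanceTwoPair X → AllSquaresSuitable X
  noDistanceTwoPair⇒allSquaresSuitable X noPair u u′ u″ u‴ square =
    let _ , _ , D , D′ = square-diagonals square
    in  (λ (u∈X , u″∈X) → noPair u u″ u∈X u″∈X (differsExactly⇒distance₂ D)) ,
        (λ (u′∈X , u‴∈X) → noPair u′ u‴ u′∈X u‴∈X (differsExactly⇒distance₂ D′))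

  allSquaresSuitable⇒noDistanceTwoPair : ∀ X → AllSquaresSuitable X → NoDistanceTwoPair X
  allSquaresSuitable⇒noDistanceTwoPair X suitable u v u∈X v∈X d =
    let _ , _ , D = hamming≡2⇒differsExactly (distance⇒hamming d)
        u′ , u‴ , square = differsExactly⇒∃square D
    in  proj₁ (suitable u u′ v u‴ square) (u∈X , v∈X)

theorem2p3 : (r : ℕ) → 1 ≤ r → (ns : Vec ℕ r) → (∀ i → 2 ≤ lookup ns i) →
    (X : Vertex ns → Bool) →
    (Hamming.TotalMutualVisibility ns X ⇔ Hamming.NoDistanceTwoPair ns X) ×
    (Hamming.NoDistanceTwoPair ns X ⇔ Hamming.AllSquaresSuitable ns X)
theorem2p3 r _ ns _ X =
  mk⇔ (totalMutualVisibility⇒noDistanceTwoPair ns X) (noDistanceTwoPair⇒totalMutualVisibility ns X) ,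
  mk⇔ (noDistanceTwoPair⇒allSquaresSuitable ns X) (allSquaresSuitable⇒noDistanceTwoPair ns X)
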